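{- Let $m,k\ge0$ be integers with $3k+1\le 3m+2$. Then Bob wins the feedback game on $E_{3m+2}$ with starting vertex $u_{3k+1}$.
   Context: The octahedral path $E_n$ ($n\ge1$) is the graph on vertices $u_i,v_i,w_i$ ($0\le i\le n$) whose edges are: $u_iv_i, v_iw_i, w_iu_i$ for $0\le i\le n$, and $u_iu_{i+1}, u_iw_{i+1}, v_iv_{i+1}, v_iu_{i+1}, w_iw_{i+1}, w_iv_{i+1}$ for $0\le i\le n-1$; the game with starting vertex $u_p$, $v_p$ or $w_p$ are equivalent by symmetry. The feedback game on a connected graph $G$ with a starting vertex $s$: a token is placed on $s$; two players, Alice (who moves first) and Bob, alternately move the token from its current vertex $u$ to a vertex $v$ adjacent to $u$, and the edge $uv$ is then deleted. The first player who moves the token back to $s$, or to a vertex that is isolated after deletion of the edge just used, wins. "X wins the game" means X has a winning strategy. -}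

module Defs where

open import Data.Nat using (ℕ; suc)
open import Data.Product using (_×_; _,_)
open import Data.Sum using (_⊎_)
open import Data.List using (List; []; _∷_; _++_; concatMap; upTo)
open import Data.List.Relation.Unary.Any using (Any; _─_)
open import Data.List.Membership.Propositional using (_∈_)
open import Relation.Binary.PropositionalEquality using (_≡_)
open import Relation.Nullary using (¬_)

data Kind : Set where
  U V W : Kind

-- A vertex (K , i) stands for K_i (e.g. (U , i) is u_i).
Vertex : Set
Vertex = Kind × ℕ

-- An (undirected) edge, stored as an unordered pair written as an ordered pair.
Edge : Set
Edge = Vertex × Vertex

triangle : ℕ → List Edge
triangle i = ((U , i) , (V , i)) ∷ ((V , i) , (W , i)) ∷ ((W , i) , (U , i)) ∷ []

rung : ℕ → List Edge
rung i = ((U , i) , (U , suc i)) ∷ ((U , i) , (W , suc i))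
       ∷ ((V , i) , (V , suc i)) ∷ ((V , i) , (U , suc i))
       ∷ ((W , i) , (W , suc i)) ∷ ((W , i) , (V , suc i)) ∷ []

-- edge list of the octahedral path E_n (vertices K_i with 0 ≤ i ≤ n)
octEdges : ℕ → List Edge
octEdges n = concatMap triangle (upTo (suc n)) ++ concatMap rung (upTo n)

data Move (es : List Edge) (x : Vertex) : Vertex → List Edge → Set where
  fwd : ∀ {y} (p : (x , y) ∈ es) → Move es x y (es ─ p)
  bwd : ∀ {y} (p : (y , x) ∈ es) → Move es x y (es ─ p)

Incident : Vertex → Edge → Set
Incident y (a , b) = (a ≡ y) ⊎ (b ≡ y)

Isolated : Vertex → List Edge → Set
Isolated y es = ¬ Any (Incident y) es

ImmediateWin : Vertex → Vertex → List Edge → Set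
ImmediateWin s y es' = (y ≡ s) ⊎ Isolated y es'

mutual
  -- Win s es x : the player about to move (token at x, remaining edges es,
  -- start vertex s) has a winning strategy.
  data Win (s : Vertex) (es : List Edge) (x : Vertex) : Set where
    win : ∀ {y es'} → Move es x y es' →
          ImmediateWin s y es' ⊎ Lose s es' y → Win s es x

  -- Lose s es x : the player about to move loses against every strategy,
  -- i.e. the other player has a winning strategy: every move is not an
  -- immediate win and leads to a position winning for the opponent.
  data Lose (s : Vertex) (es : List Edge) (x : Vertex) : Set where
    lose : (∀ {y es'} → Move es x y es' →
              ¬ ImmediateWin s y es' × Win s es' y) → Lose s es x

-- Bob (the second player) wins the feedback game on E_n started at s.
BobWins : ℕ → Vertex → Set
BobWins n s = Lose s (octEdges n) s

module Submission where

-- Call a set A of vertices containing the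
-- start s balanced if every y ∉ A is adjacent to s or has an even number of
-- edges into A.  If A is independent and balanced, then after any move of
-- Alice from x ∈ A to y ∉ A the number of edges from y into A is odd, so Bob
-- can move on to some z ∈ A (or straight to s), which restores balance; Alice
-- always moves from a vertex of A and never wins.
--
-- Two periodic sets through u_p, one running rightwards
-- and one leftwards, are independent and balanced except at the two
-- neighbours of u_p on the opposite side; a first move to layer p - 1 is
-- answered with the leftward set, any other with the rightward set.

open import Defs
open import Data.Bool using (Bool; true; false; _∧_; _xor_; not; if_then_else_)
open import Data.Bool.Properties using (∧-zeroʳ; ∧-identityʳ; xor-assoc; xor-comm; xor-identityʳ; not-involutive)
open import Data.Empty using (⊥-elim)
open import Data.List using (List; []; _∷_; _++_; length; concatMap; upTo; [_])
open import Data.List.Properties using (upTo-∷ʳ; concatMap-++; ++-identityʳ)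
open import Data.List.Membership.Propositional using (_∈_)
open import Data.List.Membership.Propositional.Properties using (∈-upTo⁺; ∈-++⁺ʳ; ∈-concat⁺′; ∈-map⁺)
open import Data.List.Relation.Unary.All using (All; []; _∷_; universal)
import Data.List.Relation.Unary.All as All
open import Data.List.Relation.Unary.All.Properties using (─⁺; ++⁺; concat⁺; map⁺)
open import Data.List.Relation.Unary.Any using (here; there; _─_)
import Data.List.Relation.Unary.Any as Any
open import Data.Nat using (ℕ; zero; suc; pred; _+_; _*_; _≤_; _<_; z≤n; s≤s; _≡ᵇ_; _<ᵇ_; _≤ᵇ_)
open import Data.Nat.Properties
  using ( _≟_; _≤?_; _<?_; *-suc; +-assoc; ≤-pred; 1+n≢n; suc-injective; <⇒≱; ≤⇒≯; ≤-trans; ≤-refl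
        ; <-trans; n≤1+n; n<1+n; <-cmp; <⇒≤; ≤-reflexive; ≤∧≢⇒<; <⇒≢; pred[n]≤n )
open import Data.Product using (Σ; _×_; _,_; proj₁; proj₂)
open import Data.Product.Properties using (≡-dec)
open import Data.Sum using (_⊎_; inj₁; inj₂; swap) renaming (map to ⊎-map)
open import Function.Base using (_∘_)
open import Relation.Binary.Definitions using (Tri; tri<; tri≈; tri>)
open import Relation.Binary.PropositionalEquality
  using (_≡_; _≢_; refl; sym; trans; cong; cong₂; subst; ≢-sym; module ≡-Reasoning)
open import Relation.Nullary using (¬_; Dec; does; yes; no)
open import Relation.Nullary.Decidable using (dec-true; dec-false)

-- Equality of vertices: decidable, and as a Boolean test that evaluates
-- on concrete kinds, which is what the parity computations below need.

_≟K_ : (K L : Kind) → Dec (K ≡ L)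
U ≟K U = yes refl
V ≟K V = yes refl
W ≟K W = yes refl
U ≟K V = no λ ()
U ≟K W = no λ ()
V ≟K U = no λ ()
V ≟K W = no λ ()
W ≟K U = no λ ()
W ≟K V = no λ ()

_≟V_ : (x y : Vertex) → Dec (x ≡ y)
_≟V_ = ≡-dec _≟K_ _≟_

_==_ : Vertex → Vertex → Bool
x == y = does (x ≟V y)

==-refl : ∀ x → (x == x) ≡ true
==-refl x = dec-true (x ≟V x) refl

==-false : ∀ {x y} → x ≢ y → (x == y) ≡ false
==-false {x} {y} = dec-false (x ≟V y)

≡ᵇ-refl : ∀ i → (i ≡ᵇ i) ≡ true
≡ᵇ-refl i = dec-true (i ≟ i) refl

≡ᵇ-false : ∀ {i j} → i ≢ j → (i ≡ᵇ j) ≡ false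
≡ᵇ-false {i} {j} = dec-false (i ≟ j)

VertexSet : Set
VertexSet = Vertex → Bool

Joins : Vertex → Vertex → Edge → Set
Joins x y e = (e ≡ (x , y)) ⊎ (e ≡ (y , x))

Adjacent : Vertex → Vertex → List Edge → Set
Adjacent x y es = ((x , y) ∈ es) ⊎ ((y , x) ∈ es)

intoA : VertexSet → Vertex → Edge → Bool
intoA A y (a , b) = if a == y then A b else (if b == y then A a else false)

parity : VertexSet → Vertex → List Edge → Bool
parity A y []       = false
parity A y (e ∷ es) = intoA A y e xor parity A y es

Independent : VertexSet → List Edge → Set
Independent A es = All (λ e → (A (proj₁ e) ∧ A (proj₂ e)) ≡ false) es

Safe : VertexSet → Vertex → Vertex → List Edge → Set
Safe A s y es = Adjacent y s es ⊎ (parity A y es ≡ false)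

Balanced : VertexSet → Vertex → List Edge → Set
Balanced A s es = ∀ y → A y ≡ false → Safe A s y es

parity-─ : ∀ A y {e} es (p : e ∈ es) → parity A y es ≡ intoA A y e xor parity A y (es ─ p)
parity-─ A y (e ∷ es) (here refl) = refl
parity-─ A y {e} (f ∷ es) (there p) = begin
  intoA A y f xor parity A y es                              ≡⟨ cong (intoA A y f xor_) (parity-─ A y es p) ⟩
  intoA A y f xor (intoA A y e xor parity A y (es ─ p))      ≡⟨ sym (xor-assoc (intoA A y f) (intoA A y e) _) ⟩
  (intoA A y f xor intoA A y e) xor parity A y (es ─ p)
    ≡⟨ cong (_xor parity A y (es ─ p)) (xor-comm (intoA A y f) (intoA A y e)) ⟩
  (intoA A y e xor intoA A y f) xor parity A y (es ─ p)      ≡⟨ xor-assoc (intoA A y e) (intoA A y f) _ ⟩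
  intoA A y e xor (intoA A y f xor parity A y (es ─ p))      ∎
  where open ≡-Reasoning

parity-flip : ∀ A y {e} es (p : e ∈ es) → intoA A y e ≡ true → parity A y (es ─ p) ≡ not (parity A y es)
parity-flip A y es p into rewrite parity-─ A y es p | into = sym (not-involutive _)

parity-keep : ∀ A y {e} es (p : e ∈ es) → intoA A y e ≡ false → parity A y (es ─ p) ≡ parity A y es
parity-keep A y es p out rewrite parity-─ A y es p | out = refl

∈-─ : ∀ {e f : Edge} es (p : e ∈ es) → f ∈ es → f ≢ e → f ∈ (es ─ p)
∈-─ (e ∷ es) (here refl) (here refl) f≢e = ⊥-elim (f≢e refl)
∈-─ (e ∷ es) (here refl) (there q)   f≢e = q
∈-─ (e ∷ es) (there p)   (here refl) f≢e = here refl
∈-─ (e ∷ es) (there p)   (there q)   f≢e = there (∈-─ es p q f≢e)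

Adjacent-─ : ∀ {x y e} es (p : e ∈ es) → Adjacent x y es → ¬ Joins x y e → Adjacent x y (es ─ p)
Adjacent-─ es p (inj₁ m) ¬xy = inj₁ (∈-─ es p m (λ eq → ¬xy (inj₁ (sym eq))))
Adjacent-─ es p (inj₂ m) ¬xy = inj₂ (∈-─ es p m (λ eq → ¬xy (inj₂ (sym eq))))

length-─ : ∀ {e : Edge} es (p : e ∈ es) → suc (length (es ─ p)) ≡ length es
length-─ (e ∷ es) (here refl) = refl
length-─ (e ∷ es) (there p)   = cong suc (length-─ es p)

Adjacent⇒¬Isolated : ∀ {y z es} → Adjacent y z es → ¬ Isolated y es
Adjacent⇒¬Isolated (inj₁ m) iso = iso (Any.map (λ { refl → inj₁ refl }) m)
Adjacent⇒¬Isolated (inj₂ m) iso = iso (Any.map (λ { refl → inj₂ refl }) m)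

∈A⇒≢ : ∀ (A : VertexSet) {x y} → A x ≡ true → A y ≡ false → x ≢ y
∈A⇒≢ A Ax Ay refl with trans (sym Ax) Ay
... | ()

intoA-hit : ∀ A {x y e} → A x ≡ true → A y ≡ false → Joins x y e → intoA A y e ≡ true
intoA-hit A {x} {y} Ax Ay (inj₁ refl) rewrite ==-false (∈A⇒≢ A Ax Ay) | ==-refl y = Ax
intoA-hit A {x} {y} Ax Ay (inj₂ refl) rewrite ==-refl y = Ax

intoA-miss : ∀ A {x y y′ e} → A x ≡ true → A y ≡ false → y′ ≢ y → Joins x y e → intoA A y′ e ≡ false
intoA-miss A {x} {y} {y′} Ax Ay y′≢y (inj₁ refl) rewrite ==-false (λ eq → y′≢y (sym eq)) with x == y′
... | true  = Ay
... | false = refl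
intoA-miss A {x} {y} {y′} Ax Ay y′≢y (inj₂ refl) rewrite ==-false (λ eq → y′≢y (sym eq)) with x == y′
... | true  = Ay
... | false = refl

odd⇒neighbour : ∀ A y es → parity A y es ≡ true → Σ Vertex λ z → A z ≡ true × Adjacent y z es
odd⇒neighbour A y ((a , b) ∷ es) odd with intoA A y (a , b) in into
... | false = let z , Az , yz = odd⇒neighbour A y es odd in
              z , Az , ⊎-map there there yz
... | true with a ≟V y
...   | yes refl = b , into , inj₁ (here refl)
...   | no _ with b ≟V y
...     | yes refl = a , into , inj₂ (here refl)
...     | no _ with () ← into

independent-outside : ∀ A {x y e} es → Independent A es → e ∈ es → A x ≡ true → Joins x y e → A y ≡ false
independent-outside A es ind p Ax (inj₁ refl) with All.lookup ind p
... | xy rewrite Ax = xy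
independent-outside A {y = y} es ind p Ax (inj₂ refl) with All.lookup ind p
... | yx rewrite Ax = trans (sym (∧-identityʳ (A y))) yx

loseByAnswers : ∀ {s es x} →
  (∀ y {e} (p : e ∈ es) → Joins x y e → ¬ ImmediateWin s y (es ─ p) × Win s (es ─ p) y) →
  Lose s es x
loseByAnswers answer = lose λ { (fwd p) → answer _ p (inj₁ refl) ; (bwd p) → answer _ p (inj₂ refl) }

winAlong : ∀ {s es x z} → Adjacent x z es →
  (∀ {e} (q : e ∈ es) → Joins x z e → ImmediateWin s z (es ─ q) ⊎ Lose s (es ─ q) z) →
  Win s es x
winAlong (inj₁ q) good = win (fwd q) (good q (inj₁ refl))
winAlong (inj₂ q) good = win (bwd q) (good q (inj₂ refl))

module Pairing (A : VertexSet) (s : Vertex) (s∈A : A s ≡ true) where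

  ¬Joins-start : ∀ {a b y e} → A a ≡ true → A b ≡ false → (y ≢ b ⊎ a ≢ s) → Joins a b e → ¬ Joins y s e
  ¬Joins-start Aa Ab _          (inj₁ refl) (inj₁ refl) = ∈A⇒≢ A s∈A Ab refl
  ¬Joins-start Aa Ab (inj₁ y≢b) (inj₁ refl) (inj₂ refl) = y≢b refl
  ¬Joins-start Aa Ab (inj₂ a≢s) (inj₁ refl) (inj₂ refl) = a≢s refl
  ¬Joins-start Aa Ab (inj₁ y≢b) (inj₂ refl) (inj₁ refl) = y≢b refl
  ¬Joins-start Aa Ab (inj₂ a≢s) (inj₂ refl) (inj₁ refl) = a≢s refl
  ¬Joins-start Aa Ab _          (inj₂ refl) (inj₂ refl) = ∈A⇒≢ A s∈A Ab refl

  safe-─ : ∀ {a b y e} es (p : e ∈ es) → A a ≡ true → A b ≡ false → Joins a b e → y ≢ b →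
           Safe A s y es → Safe A s y (es ─ p)
  safe-─ es p Aa Ab ab y≢b (inj₁ ys)   = inj₁ (Adjacent-─ es p ys (¬Joins-start Aa Ab (inj₁ y≢b) ab))
  safe-─ es p Aa Ab ab y≢b (inj₂ even) =
    inj₂ (trans (parity-keep A _ es p (intoA-miss A Aa Ab y≢b ab)) even)

  noImmediateWin : ∀ {y z es} → A y ≡ false → Adjacent y z es → ¬ ImmediateWin s y es
  noImmediateWin Ay yz (inj₁ refl) = ∈A⇒≢ A s∈A Ay refl
  noImmediateWin Ay yz (inj₂ iso)  = Adjacent⇒¬Isolated yz iso

  -- The number of edges bounds the length of the game and serves as fuel.
  mutual
    moverLoses : ∀ k es x → length es ≤ k → A x ≡ true → x ≢ s →
                 Independent A es → Balanced A s es → Lose s es x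
    moverLoses zero    []  x _   _  _   _   _   = loseByAnswers λ _ ()
    moverLoses (suc k) es  x len Ax x≢s ind bal = loseByAnswers answer
      where
      answer : ∀ y {e} (p : e ∈ es) → Joins x y e → ¬ ImmediateWin s y (es ─ p) × Win s (es ─ p) y
      answer y p xy = bySafety (bal y Ay)
        where
        Ay : A y ≡ false
        Ay = independent-outside A es ind p Ax xy
        -- if y is still adjacent to s, the reply y → s wins at once
        bySafety : Safe A s y es → ¬ ImmediateWin s y (es ─ p) × Win s (es ─ p) y
        bySafety (inj₂ even) = replyInto k es x y p xy len Ax ind bal even
        bySafety (inj₁ ys)   = noImmediateWin Ay ys′ , winAlong ys′ λ _ _ → inj₁ (inj₁ refl)
          where
          ys′ : Adjacent y s (es ─ p)
          ys′ = Adjacent-─ es p ys (¬Joins-start Ax Ay (inj₂ x≢s) xy)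

    -- After the move x → y with x ∈ A and y even, the number of edges from y
    -- into A is odd, so there is a reply y → z with z ∈ A; it restores balance.
    replyInto : ∀ k es x y {e} (p : e ∈ es) → Joins x y e → length es ≤ suc k → A x ≡ true →
                Independent A es → Balanced A s es → parity A y es ≡ false →
                ¬ ImmediateWin s y (es ─ p) × Win s (es ─ p) y
    replyInto k es x y p xy len Ax ind bal even = replyVia (odd⇒neighbour A y es₁ odd)
      where
      Ay : A y ≡ false
      Ay = independent-outside A es ind p Ax xy
      es₁ : List Edge
      es₁ = es ─ p
      odd : parity A y es₁ ≡ true
      odd = trans (parity-flip A y es p (intoA-hit A Ax Ay xy)) (cong not even)
      replyVia : Σ Vertex (λ z → A z ≡ true × Adjacent y z es₁) →
                 ¬ ImmediateWin s y es₁ × Win s es₁ y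
      replyVia (z , Az , yz) = noImmediateWin Ay yz , winAlong yz reply
        where
        reply : ∀ {f} (q : f ∈ es₁) → Joins y z f → ImmediateWin s z (es₁ ─ q) ⊎ Lose s (es₁ ─ q) z
        reply q yz′ with z ≟V s
        ... | yes z≡s = inj₁ (inj₁ z≡s)
        ... | no  z≢s = inj₂ (moverLoses k (es₁ ─ q) z len′ Az z≢s (─⁺ q (─⁺ p ind)) bal′)
          where
          zy : Joins z y _
          zy = swap yz′
          twoFewer : suc (suc (length (es₁ ─ q))) ≡ length es
          twoFewer = trans (cong suc (length-─ es₁ q)) (length-─ es p)
          len′ : length (es₁ ─ q) ≤ k
          len′ = ≤-trans (n≤1+n _) (≤-pred (subst (_≤ suc k) (sym twoFewer) len))
          bal′ : Balanced A s (es₁ ─ q)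
          bal′ y′ Ay′ with y′ ≟V y
          ... | yes refl = inj₂ (trans (parity-flip A y es₁ q (intoA-hit A Az Ay zy)) (cong not odd))
          ... | no y′≢y  = safe-─ es₁ q Az Ay zy y′≢y (safe-─ es p Ax Ay xy y′≢y (bal y′ Ay′))

  firstMoveLoses : ∀ es y {e} (p : e ∈ es) → Joins s y e → Independent A es → Balanced A s es →
                   parity A y es ≡ false → ¬ ImmediateWin s y (es ─ p) × Win s (es ─ p) y
  firstMoveLoses es y p sy ind bal even = replyInto (length es) es s y p sy (n≤1+n _) s∈A ind bal even

PairingSet : Vertex → List Edge → Vertex → Set
PairingSet s es y = Σ VertexSet λ A →
  A s ≡ true × Independent A es × Balanced A s es × parity A y es ≡ false

bobWinsByPairing : ∀ s es → (∀ y {e} → e ∈ es → Joins s y e → PairingSet s es y) → Lose s es s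
bobWinsByPairing s es pairing = loseByAnswers answer
  where
  answer : ∀ y {e} (p : e ∈ es) → Joins s y e → ¬ ImmediateWin s y (es ─ p) × Win s (es ─ p) y
  answer y p sy with pairing y p sy
  ... | A , s∈A , ind , bal , even = Pairing.firstMoveLoses A s s∈A es y p sy ind bal even

<ᵇ-true : ∀ {m n} → m < n → (m <ᵇ n) ≡ true
<ᵇ-true {m} {n} = dec-true (m <? n)

<ᵇ-false : ∀ {m n} → n ≤ m → (m <ᵇ n) ≡ false
<ᵇ-false {m} {n} n≤m = dec-false (m <? n) (≤⇒≯ n≤m)

≤ᵇ-true : ∀ {m n} → m ≤ n → (m ≤ᵇ n) ≡ true
≤ᵇ-true {m} {n} = dec-true (m ≤? n)

≤ᵇ-false : ∀ {m n} → n < m → (m ≤ᵇ n) ≡ false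
≤ᵇ-false {m} {n} n<m = dec-false (m ≤? n) (<⇒≱ n<m)

<ᵇ-skip : ∀ a N → N ≢ a → (a <ᵇ suc N) ≡ (a <ᵇ N)
<ᵇ-skip zero    zero    N≢a = ⊥-elim (N≢a refl)
<ᵇ-skip zero    (suc N) N≢a = refl
<ᵇ-skip (suc a) zero    N≢a = refl
<ᵇ-skip (suc a) (suc N) N≢a = <ᵇ-skip a N (λ eq → N≢a (cong suc eq))

parity-++ : ∀ A y xs ys → parity A y (xs ++ ys) ≡ parity A y xs xor parity A y ys
parity-++ A y []       ys = refl
parity-++ A y (e ∷ xs) ys rewrite parity-++ A y xs ys = sym (xor-assoc (intoA A y e) _ _)

parity-concatMap-suc : ∀ A y (f : ℕ → List Edge) N →
  parity A y (concatMap f (upTo (suc N))) ≡ parity A y (concatMap f (upTo N)) xor parity A y (f N)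
parity-concatMap-suc A y f N = begin
  parity A y (concatMap f (upTo (suc N)))                      ≡⟨ cong (parity A y ∘ concatMap f) (sym (upTo-∷ʳ N)) ⟩
  parity A y (concatMap f (upTo N ++ [ N ]))                   ≡⟨ cong (parity A y) (concatMap-++ f (upTo N) [ N ]) ⟩
  parity A y (concatMap f (upTo N) ++ (f N ++ []))             ≡⟨ parity-++ A y (concatMap f (upTo N)) (f N ++ []) ⟩
  parity A y (concatMap f (upTo N)) xor parity A y (f N ++ [])
    ≡⟨ cong (λ es → parity A y (concatMap f (upTo N)) xor parity A y es) (++-identityʳ (f N)) ⟩
  parity A y (concatMap f (upTo N)) xor parity A y (f N)       ∎
  where open ≡-Reasoning

parity-concatMap-one : ∀ A y (f : ℕ → List Edge) a → (∀ j → j ≢ a → parity A y (f j) ≡ false) →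
  ∀ N → parity A y (concatMap f (upTo N)) ≡ parity A y (f a) ∧ (a <ᵇ N)
parity-concatMap-one A y f a off zero = sym (∧-zeroʳ _)
parity-concatMap-one A y f a off (suc N)
  rewrite parity-concatMap-suc A y f N | parity-concatMap-one A y f a off N with N ≟ a
... | yes refl rewrite <ᵇ-false (≤-refl {N}) | <ᵇ-true (n<1+n N) | ∧-zeroʳ (parity A y (f N))
                     | ∧-identityʳ (parity A y (f N)) = refl
... | no N≢a rewrite off N N≢a | <ᵇ-skip a N N≢a = xor-identityʳ _

parity-concatMap-two : ∀ A y (f : ℕ → List Edge) a b → a ≢ b →
  (∀ j → j ≢ a → j ≢ b → parity A y (f j) ≡ false) →
  ∀ N → parity A y (concatMap f (upTo N)) ≡ (parity A y (f a) ∧ (a <ᵇ N)) xor (parity A y (f b) ∧ (b <ᵇ N))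
parity-concatMap-two A y f a b a≢b off zero
  rewrite ∧-zeroʳ (parity A y (f a)) | ∧-zeroʳ (parity A y (f b)) = refl
parity-concatMap-two A y f a b a≢b off (suc N)
  rewrite parity-concatMap-suc A y f N | parity-concatMap-two A y f a b a≢b off N with N ≟ a | N ≟ b
... | yes refl | yes refl = ⊥-elim (a≢b refl)
... | yes refl | no N≢b
  rewrite <ᵇ-false (≤-refl {N}) | <ᵇ-true (n<1+n N) | <ᵇ-skip b N N≢b
        | ∧-zeroʳ (parity A y (f N)) | ∧-identityʳ (parity A y (f N)) =
  xor-comm (parity A y (f b) ∧ (b <ᵇ N)) (parity A y (f N))
... | no N≢a | yes refl
  rewrite <ᵇ-false (≤-refl {N}) | <ᵇ-true (n<1+n N) | <ᵇ-skip a N N≢a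
        | ∧-zeroʳ (parity A y (f N)) | ∧-identityʳ (parity A y (f N)) =
  cong (_xor parity A y (f N)) (xor-identityʳ (parity A y (f a) ∧ (a <ᵇ N)))
... | no N≢a | no N≢b rewrite off N N≢a N≢b | <ᵇ-skip a N N≢a | <ᵇ-skip b N N≢b = xor-identityʳ _

Layer : Set
Layer = Kind → Bool

layer : VertexSet → ℕ → Layer
layer A j K = A (K , j)

-- parity of the A-neighbours of K_i in its own triangle (layer L = layer i)
inTriangle : Layer → Kind → Bool
inTriangle L U = L V xor L W
inTriangle L V = L U xor L W
inTriangle L W = L V xor L U

-- parity of the A-neighbours of K_i in the next layer L = layer (i + 1)
inNext : Layer → Kind → Bool
inNext L U = L U xor L W
inNext L V = L V xor L U
inNext L W = L W xor L V

-- parity of the A-neighbours of K_(i+1) in the previous layer L = layer i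
inPrevious : Layer → Kind → Bool
inPrevious L U = L U xor L V
inPrevious L V = L V xor L W
inPrevious L W = L U xor L W

triangle-off : ∀ A K {i j} → j ≢ i → parity A (K , i) (triangle j) ≡ false
triangle-off A U j≢i rewrite ≡ᵇ-false j≢i = refl
triangle-off A V j≢i rewrite ≡ᵇ-false j≢i = refl
triangle-off A W j≢i rewrite ≡ᵇ-false j≢i = refl

triangle-on : ∀ A K i → parity A (K , i) (triangle i) ≡ inTriangle (layer A i) K
triangle-on A U i rewrite ≡ᵇ-refl i = cong (A (V , i) xor_) (xor-identityʳ (A (W , i)))
triangle-on A V i rewrite ≡ᵇ-refl i = cong (A (U , i) xor_) (xor-identityʳ (A (W , i)))
triangle-on A W i rewrite ≡ᵇ-refl i = cong (A (V , i) xor_) (xor-identityʳ (A (U , i)))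

rung-off : ∀ A K {i j} → j ≢ i → suc j ≢ i → parity A (K , i) (rung j) ≡ false
rung-off A U j≢i 1+j≢i rewrite ≡ᵇ-false j≢i | ≡ᵇ-false 1+j≢i = refl
rung-off A V j≢i 1+j≢i rewrite ≡ᵇ-false j≢i | ≡ᵇ-false 1+j≢i = refl
rung-off A W j≢i 1+j≢i rewrite ≡ᵇ-false j≢i | ≡ᵇ-false 1+j≢i = refl

rung-lower : ∀ A K i → parity A (K , i) (rung i) ≡ inNext (layer A (suc i)) K
rung-lower A U i rewrite ≡ᵇ-refl i | ≡ᵇ-false (1+n≢n {i}) = cong (A (U , suc i) xor_) (xor-identityʳ (A (W , suc i)))
rung-lower A V i rewrite ≡ᵇ-refl i | ≡ᵇ-false (1+n≢n {i}) = cong (A (V , suc i) xor_) (xor-identityʳ (A (U , suc i)))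
rung-lower A W i rewrite ≡ᵇ-refl i | ≡ᵇ-false (1+n≢n {i}) = cong (A (W , suc i) xor_) (xor-identityʳ (A (V , suc i)))

rung-upper : ∀ A K i → parity A (K , suc i) (rung i) ≡ inPrevious (layer A i) K
rung-upper A U i rewrite ≡ᵇ-refl i | ≡ᵇ-false (≢-sym (1+n≢n {i})) = cong (A (U , i) xor_) (xor-identityʳ (A (V , i)))
rung-upper A V i rewrite ≡ᵇ-refl i | ≡ᵇ-false (≢-sym (1+n≢n {i})) = cong (A (V , i) xor_) (xor-identityʳ (A (W , i)))
rung-upper A W i rewrite ≡ᵇ-refl i | ≡ᵇ-false (≢-sym (1+n≢n {i})) = cong (A (U , i) xor_) (xor-identityʳ (A (W , i)))

rungParity : VertexSet → ℕ → Kind → ℕ → Bool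
rungParity A n K zero    = inNext (layer A 1) K ∧ (0 <ᵇ n)
rungParity A n K (suc i) =
  (inNext (layer A (suc (suc i))) K ∧ (suc i <ᵇ n)) xor (inPrevious (layer A i) K ∧ (i <ᵇ n))

parity-octEdges : ∀ A n K i →
  parity A (K , i) (octEdges n) ≡ (inTriangle (layer A i) K ∧ (i <ᵇ suc n)) xor rungParity A n K i
parity-octEdges A n K i =
  trans (parity-++ A (K , i) (concatMap triangle (upTo (suc n))) (concatMap rung (upTo n)))
        (cong₂ _xor_ triangles (rungs i))
  where
  triangles : parity A (K , i) (concatMap triangle (upTo (suc n))) ≡ inTriangle (layer A i) K ∧ (i <ᵇ suc n)
  triangles = trans (parity-concatMap-one A (K , i) triangle i (λ j → triangle-off A K) (suc n))
                    (cong (_∧ (i <ᵇ suc n)) (triangle-on A K i))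
  rungs : ∀ i → parity A (K , i) (concatMap rung (upTo n)) ≡ rungParity A n K i
  rungs zero    = trans (parity-concatMap-one A (K , 0) rung 0 (λ j j≢0 → rung-off A K j≢0 (λ ())) n)
                        (cong (_∧ (0 <ᵇ n)) (rung-lower A K 0))
  rungs (suc i) =
    trans (parity-concatMap-two A (K , suc i) rung (suc i) i 1+n≢n
             (λ j j≢1+i j≢i → rung-off A K j≢1+i (λ eq → j≢i (suc-injective eq))) n)
          (cong₂ _xor_ (cong (_∧ (suc i <ᵇ n)) (rung-lower A K (suc i)))
                       (cong (_∧ (i <ᵇ n)) (rung-upper A K i)))

data Residue : Set where
  r0 r1 r2 : Residue

next : Residue → Residue
next r0 = r1
next r1 = r2
next r2 = r0

next³ : ∀ r → next (next (next r)) ≡ r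
next³ r0 = refl
next³ r1 = refl
next³ r2 = refl

res3 : ℕ → Residue
res3 zero    = r0
res3 (suc i) = next (res3 i)

res3-period : ∀ k j → res3 (3 * k + j) ≡ res3 j
res3-period zero    j = refl
res3-period (suc k) j = begin
  res3 (3 * suc k + j)     ≡⟨ cong res3 (trans (cong (_+ j) (*-suc 3 k)) (+-assoc 3 (3 * k) j)) ⟩
  res3 (3 + (3 * k + j))   ≡⟨ next³ (res3 (3 * k + j)) ⟩
  res3 (3 * k + j)         ≡⟨ res3-period k j ⟩
  res3 j                   ∎
  where open ≡-Reasoning

Pattern : Set
Pattern = Kind → Residue → Bool

periodic : (ℕ → Bool) → Pattern → VertexSet
periodic c κ (K , j) = c j ∧ κ K (res3 j)

-- κ never chooses both ends of an edge of a triangle, or of a rung between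
-- consecutive layers; this makes every periodic set with pattern κ independent.
record Admissible (κ : Pattern) : Set where
  field
    in-triangle : ∀ r → All (λ KL → (κ (proj₁ KL) r ∧ κ (proj₂ KL) r) ≡ false)
                             ((U , V) ∷ (V , W) ∷ (W , U) ∷ [])
    along-rung  : ∀ r → All (λ KL → (κ (proj₁ KL) r ∧ κ (proj₂ KL) (next r)) ≡ false)
                             ((U , U) ∷ (U , W) ∷ (V , V) ∷ (V , U) ∷ (W , W) ∷ (W , V) ∷ [])

∧-restrict : ∀ a b {x y} → (x ∧ y) ≡ false → ((a ∧ x) ∧ (b ∧ y)) ≡ false
∧-restrict false b     xy = refl
∧-restrict true  false {x} xy = ∧-zeroʳ x
∧-restrict true  true  xy = xy

periodic-independent : ∀ {κ} → Admissible κ → ∀ c n → Independent (periodic c κ) (octEdges n)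
periodic-independent {κ} adm c n =
  ++⁺ (concat⁺ (map⁺ (universal inTriangle-free (upTo (suc n)))))
      (concat⁺ (map⁺ (universal alongRung-free (upTo n))))
  where
  open Admissible adm
  inTriangle-free : ∀ j → Independent (periodic c κ) (triangle j)
  inTriangle-free j with in-triangle (res3 j)
  ... | uv ∷ vw ∷ wu ∷ [] = r uv ∷ r vw ∷ r wu ∷ []
    where
    r : ∀ {x y} → (x ∧ y) ≡ false → ((c j ∧ x) ∧ (c j ∧ y)) ≡ false
    r = ∧-restrict (c j) (c j)
  alongRung-free : ∀ j → Independent (periodic c κ) (rung j)
  alongRung-free j with along-rung (res3 j)
  ... | uu ∷ uw ∷ vv ∷ vu ∷ ww ∷ wv ∷ [] =
    r uu ∷ r uw ∷ r vv ∷ r vu ∷ r ww ∷ r wv ∷ []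
    where
    r : ∀ {x y} → (x ∧ y) ≡ false → ((c j ∧ x) ∧ (c (suc j) ∧ y)) ≡ false
    r = ∧-restrict (c j) (c (suc j))

-- The window of a vertex K_i: which of the layers i - 1, i, i + 1 are selected
-- (layer -1 counting as unselected), the residue of layer i - 1, and which of
-- the three edge groups at K_i (triangle, rungs up, rungs down) exist in E_n.

Triple : Set
Triple = Bool × Bool × Bool

selection : (ℕ → Bool) → ℕ → Triple
selection c zero    = false , c 0 , c 1
selection c (suc i) = c i , c (suc i) , c (suc (suc i))

below : ℕ → Residue
below zero    = r2
below (suc i) = res3 i

edgeGroups : ℕ → ℕ → Triple
edgeGroups n zero    = true , (0 <ᵇ n) , false
edgeGroups n (suc i) = (suc i <ᵇ suc n) , (suc i <ᵇ n) , (i <ᵇ n)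

window : Pattern → Kind → Triple → Residue → Triple → Bool
window κ K (b₋ , b₀ , b₊) r (t₀ , t₊ , t₋) =
  (inTriangle (λ L → b₀ ∧ κ L (next r)) K ∧ t₀) xor
  ((inNext (λ L → b₊ ∧ κ L (next (next r))) K ∧ t₊) xor (inPrevious (λ L → b₋ ∧ κ L r) K ∧ t₋))

parity-window : ∀ c κ n K i →
  parity (periodic c κ) (K , i) (octEdges n) ≡ window κ K (selection c i) (below i) (edgeGroups n i)
parity-window c κ n K (suc i) = parity-octEdges (periodic c κ) n K (suc i)
parity-window c κ n K zero    =
  trans (parity-octEdges (periodic c κ) n K zero)
        (cong ((inTriangle (layer (periodic c κ) 0) K ∧ true) xor_) (sym (noLowerEdges K)))
  where
  noLowerEdges : ∀ K → ((inNext (layer (periodic c κ) 1) K ∧ (0 <ᵇ n)) xor (inPrevious (λ _ → false) K ∧ false))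
                       ≡ inNext (layer (periodic c κ) 1) K ∧ (0 <ᵇ n)
  noLowerEdges U = xor-identityʳ _
  noLowerEdges V = xor-identityʳ _
  noLowerEdges W = xor-identityʳ _

evenBy : ∀ {c κ n K i s t} → selection c i ≡ s → edgeGroups n i ≡ t → window κ K s (below i) t ≡ false →
         parity (periodic c κ) (K , i) (octEdges n) ≡ false
evenBy {c} {κ} {n} {K} {i} refl refl w = trans (parity-window c κ n K i) w

unchosen : ∀ c κ {K} i → c i ≡ true → periodic c κ (K , i) ≡ false → κ K (next (below i)) ≡ false
unchosen c κ zero    ci ∉ rewrite ci = ∉
unchosen c κ (suc i) ci ∉ rewrite ci = ∉

next-below : ∀ i → next (below i) ≡ res3 i
next-below zero    = refl
next-below (suc i) = refl

next-below-≡ : ∀ {i j r} → j ≡ i → res3 j ≡ r → next (below i) ≡ r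
next-below-≡ {i} refl = trans (next-below i)

window-empty : ∀ κ K r t → window κ K (false , false , false) r t ≡ false
window-empty κ U r t = refl
window-empty κ V r t = refl
window-empty κ W r t = refl

-- a vertex beyond the last layer has no edges
window-detached : ∀ κ K s r → window κ K s r (false , false , false) ≡ false
window-detached κ K (b₋ , b₀ , b₊) r
  rewrite ∧-zeroʳ (inTriangle (λ L → b₀ ∧ κ L (next r)) K)
        | ∧-zeroʳ (inNext (λ L → b₊ ∧ κ L (next (next r))) K)
        | ∧-zeroʳ (inPrevious (λ L → b₋ ∧ κ L r) K) = refl

triple-≡ : ∀ {a b c a′ b′ c′ : Bool} → a ≡ a′ → b ≡ b′ → c ≡ c′ → (a , b , c) ≡ (a′ , b′ , c′)
triple-≡ refl refl refl = refl

edges-bottom : ∀ {n} → 0 < n → edgeGroups n 0 ≡ (true , true , false)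
edges-bottom 0<n = triple-≡ refl (<ᵇ-true 0<n) refl

edges-inner : ∀ {n} i → 0 < i → i < n → edgeGroups n i ≡ (true , true , true)
edges-inner (suc i) _ i<n = triple-≡ (<ᵇ-true (≤-trans i<n (n≤1+n _))) (<ᵇ-true i<n) (<ᵇ-true (<-trans (n<1+n i) i<n))

edges-last : ∀ {n} i → 0 < i → i ≡ n → edgeGroups n i ≡ (true , false , true)
edges-last (suc i) _ refl = triple-≡ (<ᵇ-true (n<1+n (suc i))) (<ᵇ-false (≤-refl {suc i})) (<ᵇ-true (n<1+n i))

edges-beyond : ∀ {n} i → n < i → edgeGroups n i ≡ (false , false , false)
edges-beyond (suc i) (s≤s n≤i) =
  triple-≡ (<ᵇ-false (s≤s n≤i)) (<ᵇ-false (≤-trans n≤i (n≤1+n i))) (<ᵇ-false n≤i)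

-- The rightward set u_p, v_(p+1), u_(p+3), v_(p+4), ... : u on layers ≡ 1 and
-- v on layers ≡ 2 (mod 3), from layer p on.

rightPattern : Pattern
rightPattern U r1 = true
rightPattern V r2 = true
rightPattern _ _  = false

rightSet : ℕ → VertexSet
rightSet p = periodic (p ≤ᵇ_) rightPattern

rightPattern-admissible : Admissible rightPattern
rightPattern-admissible = record
  { in-triangle = λ { r0 → refl ∷ refl ∷ refl ∷ []
                    ; r1 → refl ∷ refl ∷ refl ∷ []
                    ; r2 → refl ∷ refl ∷ refl ∷ [] }
  ; along-rung  = λ { r0 → refl ∷ refl ∷ refl ∷ refl ∷ refl ∷ refl ∷ []
                    ; r1 → refl ∷ refl ∷ refl ∷ refl ∷ refl ∷ refl ∷ []
                    ; r2 → refl ∷ refl ∷ refl ∷ refl ∷ refl ∷ refl ∷ [] } }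

rightInterior : ∀ K r → rightPattern K (next r) ≡ false →
                window rightPattern K (true , true , true) r (true , true , true) ≡ false
rightInterior U r0 ()
rightInterior U r1 _ = refl
rightInterior U r2 _ = refl
rightInterior V r0 _ = refl
rightInterior V r1 ()
rightInterior V r2 _ = refl
rightInterior W r0 _ = refl
rightInterior W r1 _ = refl
rightInterior W r2 _ = refl

rightLast : ∀ K r → next r ≡ r2 → rightPattern K (next r) ≡ false →
            window rightPattern K (true , true , true) r (true , false , true) ≡ false
rightLast U r1 refl _ = refl
rightLast V r1 refl ()
rightLast W r1 refl _ = refl

rightStart : ∀ K r → next r ≡ r1 → rightPattern K (next r) ≡ false →
             window rightPattern K (false , true , true) r (true , true , true) ≡ false
rightStart U r0 refl ()
rightStart V r0 refl _ = refl
rightStart W r0 refl _ = refl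

-- the layer p - 1 just before the start, where only w_(p-1) is not adjacent to u_p
rightBefore : ∀ r t → next (next r) ≡ r1 → window rightPattern W (false , false , true) r t ≡ false
rightBefore r2 t refl = refl

rightSel-inside : ∀ {p} i → p < i → selection (p ≤ᵇ_) i ≡ (true , true , true)
rightSel-inside (suc i) (s≤s p≤i) =
  triple-≡ (≤ᵇ-true p≤i) (≤ᵇ-true (≤-trans p≤i (n≤1+n i)))
           (≤ᵇ-true (≤-trans p≤i (≤-trans (n≤1+n i) (n≤1+n _))))

rightSel-start : ∀ {p} i → p ≡ i → 0 < p → selection (p ≤ᵇ_) i ≡ (false , true , true)
rightSel-start (suc i) refl _ = triple-≡ (≤ᵇ-false (n<1+n i)) (≤ᵇ-true (≤-refl {suc i})) (≤ᵇ-true (n≤1+n (suc i)))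

rightSel-before : ∀ {p} i → p ≡ suc i → selection (p ≤ᵇ_) i ≡ (false , false , true)
rightSel-before zero    refl = triple-≡ refl refl refl
rightSel-before (suc i) refl =
  triple-≡ (≤ᵇ-false (≤-trans (n<1+n i) (n≤1+n _))) (≤ᵇ-false (n<1+n (suc i))) (≤ᵇ-true (≤-refl {suc (suc i)}))

rightSel-far : ∀ {p} i → suc i < p → selection (p ≤ᵇ_) i ≡ (false , false , false)
rightSel-far zero    1<p = triple-≡ refl (≤ᵇ-false (≤-trans (n≤1+n 1) 1<p)) (≤ᵇ-false 1<p)
rightSel-far (suc i) i+1<p =
  triple-≡ (≤ᵇ-false (≤-trans (n≤1+n _) (≤-trans (n≤1+n _) i+1<p)))
           (≤ᵇ-false (≤-trans (n≤1+n _) i+1<p)) (≤ᵇ-false i+1<p)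

res3-positive : ∀ {p} → res3 p ≡ r1 → 0 < p
res3-positive {suc p} _ = s≤s z≤n

rightSet-even : ∀ {p n} → res3 p ≡ r1 → res3 n ≡ r2 → p < n → ∀ K i → rightSet p (K , i) ≡ false →
                (K , i) ≢ (U , pred p) → (K , i) ≢ (V , pred p) → parity (rightSet p) (K , i) (octEdges n) ≡ false
rightSet-even {p} {n} hp hn p<n K i ∉A ≢u ≢v = byPosition (<-cmp p i)
  where
  even : ∀ {s t} → selection (p ≤ᵇ_) i ≡ s → edgeGroups n i ≡ t → window rightPattern K s (below i) t ≡ false →
         parity (rightSet p) (K , i) (octEdges n) ≡ false
  even = evenBy {p ≤ᵇ_} {rightPattern} {n} {K} {i}

  kind : p ≤ i → rightPattern K (next (below i)) ≡ false
  kind p≤i = unchosen (p ≤ᵇ_) rightPattern i (≤ᵇ-true p≤i) ∉A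

  inside : p < i → Tri (i < n) (i ≡ n) (n < i) → parity (rightSet p) (K , i) (octEdges n) ≡ false
  inside p<i (tri< i<n _ _) = even (rightSel-inside i p<i) (edges-inner i (≤-trans (s≤s z≤n) p<i) i<n)
                                   (rightInterior K (below i) (kind (<⇒≤ p<i)))
  inside p<i (tri≈ _ i≡n _) = even (rightSel-inside i p<i) (edges-last i (≤-trans (s≤s z≤n) p<i) i≡n)
                                   (rightLast K (below i) (next-below-≡ (sym i≡n) hn) (kind (<⇒≤ p<i)))
  inside p<i (tri> _ _ n<i) = even (rightSel-inside i p<i) (edges-beyond i n<i) (window-detached rightPattern K _ _)

  -- K_(p-1): only w_(p-1) is not adjacent to u_p
  before : p ≡ suc i → parity (rightSet p) (K , i) (octEdges n) ≡ false
  before p≡1+i = even (rightSel-before i p≡1+i) refl (byKind K ≢u ≢v)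
    where
    byKind : ∀ K → (K , i) ≢ (U , pred p) → (K , i) ≢ (V , pred p) →
             window rightPattern K (false , false , true) (below i) (edgeGroups n i) ≡ false
    byKind U ≢u _ = ⊥-elim (≢u (cong (U ,_) (sym (cong pred p≡1+i))))
    byKind V _ ≢v = ⊥-elim (≢v (cong (V ,_) (sym (cong pred p≡1+i))))
    byKind W _ _  = rightBefore (below i) (edgeGroups n i) (trans (cong next (next-below i)) (trans (cong res3 (sym p≡1+i)) hp))

  byPosition : Tri (p < i) (p ≡ i) (i < p) → parity (rightSet p) (K , i) (octEdges n) ≡ false
  byPosition (tri< p<i _ _) = inside p<i (<-cmp i n)
  byPosition (tri≈ _ p≡i _) =
    even (rightSel-start i p≡i (res3-positive hp))
         (edges-inner i (subst (0 <_) p≡i (res3-positive hp)) (subst (_< n) p≡i p<n))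
         (rightStart K (below i) (next-below-≡ p≡i hp) (kind (≤-reflexive p≡i)))
  byPosition (tri> _ _ i<p) with p ≟ suc i
  ... | yes p≡1+i = before p≡1+i
  ... | no  p≢1+i = even (rightSel-far i (≤∧≢⇒< i<p (≢-sym p≢1+i))) refl (window-empty rightPattern K (below i) _)

-- The leftward set u_p, w_(p-1), u_(p-3), w_(p-4), ... : u on layers ≡ 1 and
-- w on layers ≡ 0 (mod 3), up to layer p.

leftPattern : Pattern
leftPattern U r1 = true
leftPattern W r0 = true
leftPattern _ _  = false

leftSet : ℕ → VertexSet
leftSet p = periodic (_≤ᵇ p) leftPattern

leftPattern-admissible : Admissible leftPattern
leftPattern-admissible = record
  { in-triangle = λ { r0 → refl ∷ refl ∷ refl ∷ []
                    ; r1 → refl ∷ refl ∷ refl ∷ []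
                    ; r2 → refl ∷ refl ∷ refl ∷ [] }
  ; along-rung  = λ { r0 → refl ∷ refl ∷ refl ∷ refl ∷ refl ∷ refl ∷ []
                    ; r1 → refl ∷ refl ∷ refl ∷ refl ∷ refl ∷ refl ∷ []
                    ; r2 → refl ∷ refl ∷ refl ∷ refl ∷ refl ∷ refl ∷ [] } }

leftInterior : ∀ K r → leftPattern K (next r) ≡ false →
               window leftPattern K (true , true , true) r (true , true , true) ≡ false
leftInterior U r0 ()
leftInterior U r1 _ = refl
leftInterior U r2 _ = refl
leftInterior V r0 _ = refl
leftInterior V r1 _ = refl
leftInterior V r2 _ = refl
leftInterior W r0 _ = refl
leftInterior W r1 _ = refl
leftInterior W r2 ()

leftBottom : ∀ K → leftPattern K r0 ≡ false →
             window leftPattern K (false , true , true) r2 (true , true , false) ≡ false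
leftBottom U _ = refl
leftBottom V _ = refl
leftBottom W ()

leftStart : ∀ K r → next r ≡ r1 → leftPattern K (next r) ≡ false →
            window leftPattern K (true , true , false) r (true , true , true) ≡ false
leftStart U r0 refl ()
leftStart V r0 refl _ = refl
leftStart W r0 refl _ = refl

-- the layer p + 1 just after the start, where only v_(p+1) is not adjacent to u_p
leftAfter : ∀ r t → r ≡ r1 → window leftPattern V (true , false , false) r t ≡ false
leftAfter r1 t refl = refl

leftSel-bottom : ∀ {p} → 0 < p → selection (_≤ᵇ p) 0 ≡ (false , true , true)
leftSel-bottom 0<p = triple-≡ refl refl (≤ᵇ-true 0<p)

leftSel-inside : ∀ {p} i → suc i < p → selection (_≤ᵇ p) (suc i) ≡ (true , true , true)
leftSel-inside i i+1<p =
  triple-≡ (≤ᵇ-true (≤-trans (n≤1+n i) (<⇒≤ i+1<p))) (≤ᵇ-true (<⇒≤ i+1<p)) (≤ᵇ-true i+1<p)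

leftSel-start : ∀ {p} i → i ≡ p → 0 < i → selection (_≤ᵇ p) i ≡ (true , true , false)
leftSel-start (suc i) refl _ =
  triple-≡ (≤ᵇ-true (n≤1+n i)) (≤ᵇ-true (≤-refl {suc i})) (≤ᵇ-false (n<1+n (suc i)))

leftSel-after : ∀ {p} i → i ≡ suc p → selection (_≤ᵇ p) i ≡ (true , false , false)
leftSel-after {p} (suc p) refl =
  triple-≡ (≤ᵇ-true (≤-refl {p})) (≤ᵇ-false (n<1+n p)) (≤ᵇ-false (≤-trans (n<1+n p) (n≤1+n _)))

leftSel-far : ∀ {p} i → suc p < i → selection (_≤ᵇ p) i ≡ (false , false , false)
leftSel-far (suc i) (s≤s p<i) =
  triple-≡ (≤ᵇ-false p<i) (≤ᵇ-false (≤-trans p<i (n≤1+n i)))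
           (≤ᵇ-false (≤-trans p<i (≤-trans (n≤1+n i) (n≤1+n _))))

leftSet-even-before : ∀ {p n} → p < n → ∀ K i → i < p → leftSet p (K , i) ≡ false →
                      parity (leftSet p) (K , i) (octEdges n) ≡ false
leftSet-even-before {p} {n} p<n K zero 0<p ∉A =
  evenBy {_≤ᵇ p} {leftPattern} {n} {K} {0} (leftSel-bottom 0<p) (edges-bottom (<-trans 0<p p<n))
         (leftBottom K (unchosen (_≤ᵇ p) leftPattern 0 refl ∉A))
leftSet-even-before {p} {n} p<n K (suc j) j+1<p ∉A =
  evenBy {_≤ᵇ p} {leftPattern} {n} {K} {suc j}
         (leftSel-inside j j+1<p) (edges-inner (suc j) (s≤s z≤n) (<-trans j+1<p p<n))
         (leftInterior K (res3 j) (unchosen (_≤ᵇ p) leftPattern (suc j) (≤ᵇ-true (<⇒≤ j+1<p)) ∉A))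

leftSet-even : ∀ {p n} → res3 p ≡ r1 → p < n → ∀ K i → leftSet p (K , i) ≡ false →
               (K , i) ≢ (U , suc p) → (K , i) ≢ (W , suc p) → parity (leftSet p) (K , i) (octEdges n) ≡ false
leftSet-even {p} {n} hp p<n K i ∉A ≢u ≢w = byPosition (<-cmp i p)
  where
  even : ∀ {s t} → selection (_≤ᵇ p) i ≡ s → edgeGroups n i ≡ t → window leftPattern K s (below i) t ≡ false →
         parity (leftSet p) (K , i) (octEdges n) ≡ false
  even = evenBy {_≤ᵇ p} {leftPattern} {n} {K} {i}

  kind : i ≤ p → leftPattern K (next (below i)) ≡ false
  kind i≤p = unchosen (_≤ᵇ p) leftPattern i (≤ᵇ-true i≤p) ∉A

  -- K_(p+1): only v_(p+1) is not adjacent to u_p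
  after : i ≡ suc p → parity (leftSet p) (K , i) (octEdges n) ≡ false
  after i≡1+p = even (leftSel-after i i≡1+p) refl (byKind K ≢u ≢w)
    where
    byKind : ∀ K → (K , i) ≢ (U , suc p) → (K , i) ≢ (W , suc p) →
             window leftPattern K (true , false , false) (below i) (edgeGroups n i) ≡ false
    byKind U ≢u _ = ⊥-elim (≢u (cong (U ,_) i≡1+p))
    byKind W _ ≢w = ⊥-elim (≢w (cong (W ,_) i≡1+p))
    byKind V _ _  = leftAfter (below i) (edgeGroups n i) (trans (cong below i≡1+p) hp)

  byPosition : Tri (i < p) (i ≡ p) (p < i) → parity (leftSet p) (K , i) (octEdges n) ≡ false
  byPosition (tri< i<p _ _) = leftSet-even-before p<n K i i<p ∉A
  byPosition (tri≈ _ i≡p _) =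
    even (leftSel-start i i≡p 0<i) (edges-inner i 0<i (subst (_< n) (sym i≡p) p<n))
         (leftStart K (below i) (next-below-≡ (sym i≡p) hp) (kind (≤-reflexive i≡p)))
    where
    0<i : 0 < i
    0<i = subst (0 <_) (sym i≡p) (res3-positive hp)
  byPosition (tri> _ _ p<i) with i ≟ suc p
  ... | yes i≡1+p = after i≡1+p
  ... | no  i≢1+p = even (leftSel-far i (≤∧≢⇒< p<i (≢-sym i≢1+p))) refl (window-empty leftPattern K (below i) _)

rung-∈ : ∀ {e n} j → j < n → e ∈ rung j → e ∈ octEdges n
rung-∈ {n = n} j j<n m =
  ∈-++⁺ʳ (concatMap triangle (upTo (suc n))) (∈-concat⁺′ m (∈-map⁺ rung (∈-upTo⁺ j<n)))

rightSet-independent : ∀ p n → Independent (rightSet p) (octEdges n)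
rightSet-independent p = periodic-independent rightPattern-admissible (p ≤ᵇ_)

leftSet-independent : ∀ p n → Independent (leftSet p) (octEdges n)
leftSet-independent p = periodic-independent leftPattern-admissible (_≤ᵇ p)

rightSet-start : ∀ p → res3 p ≡ r1 → rightSet p (U , p) ≡ true
rightSet-start p hp rewrite ≤ᵇ-true (≤-refl {p}) | hp = refl

leftSet-start : ∀ p → res3 p ≡ r1 → leftSet p (U , p) ≡ true
leftSet-start p hp rewrite ≤ᵇ-true (≤-refl {p}) | hp = refl

-- The rightward set serves every first move except those to u_(p-1), v_(p-1),
-- which stay adjacent to u_p through the rungs below it.
rightPairing : ∀ {p n} → res3 p ≡ r1 → res3 n ≡ r2 → p < n → ∀ y → rightSet p y ≡ false →
               y ≢ (U , pred p) → y ≢ (V , pred p) → PairingSet (U , p) (octEdges n) y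
rightPairing {suc q} {n} hp hn p<n (K , i) ∉A ≢u ≢v =
  rightSet (suc q) , rightSet-start (suc q) hp , rightSet-independent (suc q) n ,
  balanced , rightSet-even hp hn p<n K i ∉A ≢u ≢v
  where
  q<n : q < n
  q<n = ≤-trans (n≤1+n _) p<n
  balanced : Balanced (rightSet (suc q)) (U , suc q) (octEdges n)
  balanced (L , j) ∉A′ with (L , j) ≟V (U , q) | (L , j) ≟V (V , q)
  ... | yes refl | _        = inj₁ (inj₁ (rung-∈ q q<n (here refl)))
  ... | no _     | yes refl = inj₁ (inj₁ (rung-∈ q q<n (there (there (there (here refl))))))
  ... | no ≢u′   | no ≢v′   = inj₂ (rightSet-even hp hn p<n L j ∉A′ ≢u′ ≢v′)

-- The leftward set serves every first move except those to u_(p+1), w_(p+1),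
-- which stay adjacent to u_p through the rungs above it.
leftPairing : ∀ {p n} → res3 p ≡ r1 → p < n → ∀ y → leftSet p y ≡ false →
              y ≢ (U , suc p) → y ≢ (W , suc p) → PairingSet (U , p) (octEdges n) y
leftPairing {p} {n} hp p<n (K , i) ∉A ≢u ≢w =
  leftSet p , leftSet-start p hp , leftSet-independent p n ,
  balanced , leftSet-even hp p<n K i ∉A ≢u ≢w
  where
  balanced : Balanced (leftSet p) (U , p) (octEdges n)
  balanced (L , j) ∉A′ with (L , j) ≟V (U , suc p) | (L , j) ≟V (W , suc p)
  ... | yes refl | _        = inj₁ (inj₂ (rung-∈ p p<n (here refl)))
  ... | no _     | yes refl = inj₁ (inj₂ (rung-∈ p p<n (there (here refl))))
  ... | no ≢u′   | no ≢w′   = inj₂ (leftSet-even hp p<n L j ∉A′ ≢u′ ≢w′)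

bobWins-mod3 : ∀ {p n} → res3 p ≡ r1 → res3 n ≡ r2 → p < n → BobWins n (U , p)
bobWins-mod3 {p} {n} hp hn p<n = bobWinsByPairing (U , p) (octEdges n) pairing
  where
  right∌ : ∀ y {e} → e ∈ octEdges n → Joins (U , p) y e → rightSet p y ≡ false
  right∌ y m sy = independent-outside (rightSet p) (octEdges n) (rightSet-independent p n) m (rightSet-start p hp) sy
  left∌ : ∀ y {e} → e ∈ octEdges n → Joins (U , p) y e → leftSet p y ≡ false
  left∌ y m sy = independent-outside (leftSet p) (octEdges n) (leftSet-independent p n) m (leftSet-start p hp) sy
  notAbove : ∀ {y K L} → y ≡ (K , pred p) → y ≢ (L , suc p)
  notAbove refl eq = <⇒≢ (s≤s (pred[n]≤n {p})) (cong proj₂ eq)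
  pairing : ∀ y {e} → e ∈ octEdges n → Joins (U , p) y e → PairingSet (U , p) (octEdges n) y
  pairing y m sy with y ≟V (U , pred p) | y ≟V (V , pred p)
  ... | no ≢u   | no ≢v   = rightPairing hp hn p<n y (right∌ y m sy) ≢u ≢v
  ... | yes y≡u | _       = leftPairing hp p<n y (left∌ y m sy) (notAbove y≡u) (notAbove y≡u)
  ... | no _    | yes y≡v = leftPairing hp p<n y (left∌ y m sy) (notAbove y≡v) (notAbove y≡v)

lemma3p3 : (m k : ℕ) → 3 * k + 1 ≤ 3 * m + 2 → BobWins (3 * m + 2) (U , 3 * k + 1)
lemma3p3 m k 3k+1≤3m+2 = bobWins-mod3 p≡1 n≡2 (≤∧≢⇒< 3k+1≤3m+2 p≢n)
  where
  p≡1 : res3 (3 * k + 1) ≡ r1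
  p≡1 = res3-period k 1
  n≡2 : res3 (3 * m + 2) ≡ r2
  n≡2 = res3-period m 2
  p≢n : 3 * k + 1 ≢ 3 * m + 2
  p≢n eq with trans (sym p≡1) (trans (cong res3 eq) n≡2)
  ... | ()
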